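{- Let $(b_1,\dots,b_{n-2})$ be an integer vector with $0\le b_i\le i$, and let $w=S(b_1,\dots,b_{n-2})$. Then $\alpha_i(w)=n-1-i-b_{n-1-i}$ for $1\le i\le n-2$. Moreover, for any permutation $w$ of $\{1,\dots,n\}$ there exists $(b_1,\dots,b_{n-2})\in\mathbb{Z}^{n-2}$ with $0\le b_i\le i$ such that $w$ is cyclically equivalent to $S(b_1,\dots,b_{n-2})$.
   Context: $S(b_1,\dots,b_{n-2})$: let $w^0=(1,2,\dots,n)$; for $1\le i\le n-2$ let $w^i=(1,2,\dots,n-i-1,\,w^{i-1}_{n-b_i+1},\dots,w^{i-1}_{n},\,n-i,\,w^{i-1}_{n-i+1},\dots,w^{i-1}_{n-b_i})$, i.e. the last $b_i$ letters of $w^{i-1}$ are moved to right after $1,\dots,n-i-1$; then $S(b_1,\dots,b_{n-2})=w^{n-2}$. (E.g. $S(1,1,2,3)=(1,6,3,5,2,4)$.) Cyclic equivalence: $(w_1,\dots,w_n)\sim(w_2,\dots,w_n,w_1)$, extended transitively. $\alpha_i(w)$ for $1\le i\le n-2$: with $r$ the position of $i+1$ and $s$ the position of $i$ in $w$, the number of integers greater than $i+1$ among $w_r,w_{r+1},\dots,w_s$ (indices mod $n$). -}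

module Defs where

open import Data.Nat using (ℕ; zero; suc; _+_; _∸_; _≤_; _<ᵇ_; _≡ᵇ_; _≤ᵇ_)
open import Data.Bool using (Bool; true; false; if_then_else_)
open import Data.List using (List; []; _∷_; _++_; [_]; map; upTo; take; drop; length; filterᵇ)
open import Relation.Binary.Construct.Closure.Equivalence using (EqClosure)

oneTo : ℕ → List ℕ
oneTo k = map suc (upTo k)

-- 1-indexed access b_i of a list (default 0 outside range; only used in range)
at : List ℕ → ℕ → ℕ
at []       _             = 0
at (x ∷ xs) zero          = 0
at (x ∷ xs) (suc zero)    = x
at (x ∷ xs) (suc (suc k)) = at xs (suc k)

-- w^i from w^{i-1} (w has length n, step index i, parameter bi):
-- (1,...,n-i-1, w_{n-bi+1},...,w_n, n-i, w_{n-i+1},...,w_{n-bi})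
step : ℕ → ℕ → ℕ → List ℕ → List ℕ
step n i bi w =
  oneTo (n ∸ i ∸ 1) ++ drop (n ∸ bi) w ++ [ n ∸ i ] ++ take (i ∸ bi) (drop (n ∸ i) w)

iterS : ℕ → ℕ → List ℕ → List ℕ → List ℕ
iterS n i w []       = w
iterS n i w (b ∷ bs) = iterS n (suc i) (step n i b w) bs

S : ℕ → List ℕ → List ℕ
S n bs = iterS n 1 (oneTo n) bs

Valid : ℕ → List ℕ → Set
Valid n bs = (length bs ≡ n ∸ 2) × (∀ i → 1 ≤ i → i ≤ n ∸ 2 → at bs i ≤ i)
  where open import Relation.Binary.PropositionalEquality using (_≡_)
        open import Data.Product using (_×_)

-- 0-indexed position of the first occurrence of x in w (length w if absent)
pos : ℕ → List ℕ → ℕ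
pos x []       = 0
pos x (y ∷ ys) = if x ≡ᵇ y then 0 else suc (pos x ys)

-- cyclic segment w_r, w_{r+1}, ..., w_s (0-indexed positions, indices mod n)
cycSeg : ℕ → ℕ → List ℕ → List ℕ
cycSeg r s w = if r ≤ᵇ s then take (suc (s ∸ r)) (drop r w)
               else drop r w ++ take (suc s) w

α : ℕ → List ℕ → ℕ
α i w = length (filterᵇ (λ x → suc i <ᵇ x) (cycSeg (pos (suc i) w) (pos i w) w))

data Rot : List ℕ → List ℕ → Set where
  rot : ∀ x xs → Rot (x ∷ xs) (xs ++ [ x ])

CycEq : List ℕ → List ℕ → Set
CycEq = EqClosure Rot

{-# OPTIONS --safe #-}

-- Write w^i = (1, …, n-i-1) ++ t_i.  Step i replaces t_{i-1} by
--   drop d t_{i-1} ++ (n-i) ∷ take d t_{i-1}   with d = i - b_i,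
-- a rotation of (n-i) ∷ t_{i-1}, and finally S = 1 ∷ t_{n-2}.  Up to rotation, step
-- k = n-1-i puts i+1 just before the d letters of take d t_{k-1}, all larger than i+1,
-- and step k+1 (or the final prefix 1 when i = 1) puts i just after them; so reading
-- cyclically from i+1 to i exactly d letters exceed i+1.  This count is invariant under
-- rotation and under inserting letters smaller than i, which is all that happens later.
-- Conversely t_i ranges over all arrangements of n-i, …, n: deleting n-i and rotating
-- leaves an arrangement of n-i+1, …, n, and a suitable b_i puts n-i back.  Rotating a
-- permutation so that it starts with 1 then exhibits it as S(b) up to rotation.
module Submission where

open import Defs
open import Data.Bool using (true; false; T?)
open import Data.Bool.Properties using (T-≡; ¬-not)
open import Data.Nat
  using (ℕ; zero; suc; _+_; _∸_; _≤_; _<_; z≤n; s≤s; s≤s⁻¹; z<s; _⊓_; _<ᵇ_; _≡ᵇ_; _≤ᵇ_)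
open import Data.Nat.Properties
open import Data.List using (List; []; _∷_; _++_; [_]; map; upTo; take; drop; length; filterᵇ; applyUpTo)
open import Data.List.Properties
  using (++-assoc; ++-identityʳ; length-++; length-map; length-upTo; length-take; take++drop≡id;
         map-++; upTo-∷ʳ; map-upTo; filter-++; filter-all; filter-reject)
open import Data.List.Relation.Unary.All as All using (All; []; _∷_)
open import Data.List.Relation.Unary.All.Properties using (++⁺; drop⁺; take⁺)
open import Data.List.Relation.Unary.Any using (here)
open import Data.List.Membership.Propositional.Properties using (∈-∃++)
open import Data.List.Relation.Binary.Permutation.Propositional using (_↭_; ↭-sym; ↭-trans)
open import Data.List.Relation.Binary.Permutation.Propositional.Properties
  using (↭-singleton-inv; drop-mid; ∈-resp-↭; ↭-length) renaming (++-comm to ↭-++-comm)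
open import Function.Base using (_∘_)
open import Data.Product using (_×_; _,_; proj₁; proj₂; Σ-syntax; ∃-syntax)
open import Function.Bundles using (Equivalence)
open import Relation.Binary.Construct.Closure.ReflexiveTransitive as Star using (Star; ε; _◅_)
open import Relation.Binary.Construct.Closure.Symmetric using (fwd)
open import Relation.Binary.PropositionalEquality hiding ([_])

drop-++-length : ∀ (xs ys : List ℕ) k → drop (length xs + k) (xs ++ ys) ≡ drop k ys
drop-++-length []       ys k = refl
drop-++-length (x ∷ xs) ys k = drop-++-length xs ys k

drop-length-++ : ∀ (xs ys : List ℕ) → drop (length xs) (xs ++ ys) ≡ ys
drop-length-++ []       ys = refl
drop-length-++ (x ∷ xs) ys = drop-length-++ xs ys

take-++-length : ∀ (xs ys : List ℕ) k → take (length xs + k) (xs ++ ys) ≡ xs ++ take k ys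
take-++-length []       ys k = refl
take-++-length (x ∷ xs) ys k = cong (x ∷_) (take-++-length xs ys k)

snoc-inner : ∀ {x y z : ℕ} xs ys zs → (xs ++ x ∷ ys ++ y ∷ zs) ++ [ z ] ≡ xs ++ x ∷ ys ++ y ∷ zs ++ [ z ]
snoc-inner {x} {y} {z} xs ys zs =
  trans (++-assoc xs (x ∷ ys ++ y ∷ zs) [ z ]) (cong (λ us → xs ++ x ∷ us) (++-assoc ys (y ∷ zs) [ z ]))

≡ᵇ-refl : ∀ x → (x ≡ᵇ x) ≡ true
≡ᵇ-refl x = Equivalence.to T-≡ (≡⇒≡ᵇ x x refl)

≢⇒≡ᵇ-false : ∀ {x y} → x ≢ y → (x ≡ᵇ y) ≡ false
≢⇒≡ᵇ-false {x} {y} x≢y = ¬-not (λ eq → x≢y (≡ᵇ⇒≡ x y (Equivalence.from T-≡ eq)))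

≤⇒≤ᵇ-true : ∀ {m n} → m ≤ n → (m ≤ᵇ n) ≡ true
≤⇒≤ᵇ-true m≤n = Equivalence.to T-≡ (≤⇒≤ᵇ m≤n)

>⇒≤ᵇ-false : ∀ {m n} → n < m → (m ≤ᵇ n) ≡ false
>⇒≤ᵇ-false {m} {n} n<m = ¬-not (λ eq → <⇒≱ n<m (≤ᵇ⇒≤ m n (Equivalence.from T-≡ eq)))

pos-++ : ∀ x xs ys → All (x ≢_) xs → pos x (xs ++ x ∷ ys) ≡ length xs
pos-++ x []       ys []           rewrite ≡ᵇ-refl x = refl
pos-++ x (y ∷ xs) ys (x≢y ∷ x∉xs) rewrite ≢⇒≡ᵇ-false x≢y = cong suc (pos-++ x xs ys x∉xs)

pos-++-++ : ∀ {x y} xs ys zs → All (x ≢_) xs → x ≢ y → All (x ≢_) ys →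
            pos x (xs ++ y ∷ ys ++ x ∷ zs) ≡ length xs + suc (length ys)
pos-++-++ {x} {y} xs ys zs x∉xs x≢y x∉ys = begin
  pos x (xs ++ y ∷ ys ++ x ∷ zs)   ≡⟨ cong (pos x) (sym (++-assoc xs (y ∷ ys) (x ∷ zs))) ⟩
  pos x ((xs ++ y ∷ ys) ++ x ∷ zs) ≡⟨ pos-++ x (xs ++ y ∷ ys) zs (++⁺ x∉xs (x≢y ∷ x∉ys)) ⟩
  length (xs ++ y ∷ ys)            ≡⟨ length-++ xs ⟩
  length xs + suc (length ys)      ∎
  where open ≡-Reasoning

cycSeg-forward : ∀ (xs ys zs : List ℕ) x y →
  cycSeg (length xs) (length xs + suc (length ys)) (xs ++ x ∷ ys ++ y ∷ zs) ≡ x ∷ ys ++ [ y ]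
cycSeg-forward xs ys zs x y
  rewrite ≤⇒≤ᵇ-true (m≤m+n (length xs) (suc (length ys)))
        | m+n∸m≡n (length xs) (suc (length ys))
        | drop-length-++ xs (x ∷ ys ++ y ∷ zs)
        | +-comm 1 (length ys)
        = cong (x ∷_) (take-++-length ys (y ∷ zs) 1)

cycSeg-wrapped : ∀ (xs ys zs : List ℕ) x y →
  cycSeg (length xs + suc (length ys)) (length xs) (xs ++ y ∷ ys ++ x ∷ zs) ≡ x ∷ zs ++ xs ++ [ y ]
cycSeg-wrapped xs ys zs x y
  rewrite >⇒≤ᵇ-false (m<m+n (length xs) {suc (length ys)} z<s)
        | sym (++-assoc xs (y ∷ ys) (x ∷ zs))
        | sym (length-++ xs {y ∷ ys})
        | drop-length-++ (xs ++ y ∷ ys) (x ∷ zs)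
        | +-comm 1 (length xs)
        = cong (x ∷_) (cong (zs ++_)
            (trans (cong (take (length xs + 1)) (++-assoc xs (y ∷ ys) (x ∷ zs)))
                   (take-++-length xs (y ∷ ys ++ x ∷ zs) 1)))

countAbove : ℕ → List ℕ → ℕ
countAbove m xs = length (filterᵇ (m <ᵇ_) xs)

countAbove-++ : ∀ m xs ys → countAbove m (xs ++ ys) ≡ countAbove m xs + countAbove m ys
countAbove-++ m xs ys = trans (cong length (filter-++ (λ y → T? (m <ᵇ y)) xs ys)) (length-++ (filterᵇ (m <ᵇ_) xs))

countAbove-all : ∀ {m xs} → All (m <_) xs → countAbove m xs ≡ length xs
countAbove-all {m} m<xs = cong length (filter-all (λ y → T? (m <ᵇ y)) (All.map <⇒<ᵇ m<xs))

countAbove-∷-≤ : ∀ m x xs → x ≤ m → countAbove m (x ∷ xs) ≡ countAbove m xs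
countAbove-∷-≤ m x xs x≤m =
  cong length (filter-reject (λ y → T? (m <ᵇ y)) {x} {xs} (λ m<x → <⇒≱ (<ᵇ⇒< m x m<x) x≤m))

Avoids : ℕ → List ℕ → Set
Avoids i = All (λ z → i ≢ z × suc i ≢ z)

-- Arc i c w: read cyclically from the letter i+1 to the letter i, w has c letters
-- larger than i+1; the constructors are the two branches of cycSeg.
data Arc (i c : ℕ) : List ℕ → Set where
  forward : ∀ {xs ys zs} → Avoids i xs → Avoids i ys → Avoids i zs →
            countAbove (suc i) ys ≡ c → Arc i c (xs ++ suc i ∷ ys ++ i ∷ zs)
  wrapped : ∀ {xs ys zs} → Avoids i xs → Avoids i ys → Avoids i zs →
            countAbove (suc i) zs + countAbove (suc i) xs ≡ c → Arc i c (xs ++ i ∷ ys ++ suc i ∷ zs)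

α-Arc : ∀ {i c w} → Arc i c w → α i w ≡ c
α-Arc {i} {c} (forward {xs} {ys} {zs} i∉xs i∉ys _ count) = begin
  countAbove (suc i) (cycSeg (pos (suc i) w) (pos i w) w)
    ≡⟨ cong₂ (λ r s → countAbove (suc i) (cycSeg r s w))
         (pos-++ (suc i) xs _ (All.map proj₂ i∉xs))
         (pos-++-++ xs ys zs (All.map proj₁ i∉xs) (λ ()) (All.map proj₁ i∉ys)) ⟩
  countAbove (suc i) (cycSeg (length xs) (length xs + suc (length ys)) w)
    ≡⟨ cong (countAbove (suc i)) (cycSeg-forward xs ys zs (suc i) i) ⟩
  countAbove (suc i) (suc i ∷ ys ++ [ i ])
    ≡⟨ countAbove-∷-≤ (suc i) (suc i) _ ≤-refl ⟩
  countAbove (suc i) (ys ++ [ i ])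
    ≡⟨ countAbove-++ (suc i) ys [ i ] ⟩
  countAbove (suc i) ys + countAbove (suc i) [ i ]
    ≡⟨ cong (countAbove (suc i) ys +_) (countAbove-∷-≤ (suc i) i [] (n≤1+n i)) ⟩
  countAbove (suc i) ys + 0
    ≡⟨ trans (+-identityʳ _) count ⟩
  c ∎
  where
  open ≡-Reasoning
  w = xs ++ suc i ∷ ys ++ i ∷ zs
α-Arc {i} {c} (wrapped {xs} {ys} {zs} i∉xs i∉ys _ count) = begin
  countAbove (suc i) (cycSeg (pos (suc i) w) (pos i w) w)
    ≡⟨ cong₂ (λ r s → countAbove (suc i) (cycSeg r s w))
         (pos-++-++ xs ys zs (All.map proj₂ i∉xs) (λ ()) (All.map proj₂ i∉ys))
         (pos-++ i xs _ (All.map proj₁ i∉xs)) ⟩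
  countAbove (suc i) (cycSeg (length xs + suc (length ys)) (length xs) w)
    ≡⟨ cong (countAbove (suc i)) (cycSeg-wrapped xs ys zs (suc i) i) ⟩
  countAbove (suc i) (suc i ∷ zs ++ xs ++ [ i ])
    ≡⟨ countAbove-∷-≤ (suc i) (suc i) _ ≤-refl ⟩
  countAbove (suc i) (zs ++ xs ++ [ i ])
    ≡⟨ countAbove-++ (suc i) zs _ ⟩
  countAbove (suc i) zs + countAbove (suc i) (xs ++ [ i ])
    ≡⟨ cong (countAbove (suc i) zs +_) (countAbove-++ (suc i) xs [ i ]) ⟩
  countAbove (suc i) zs + (countAbove (suc i) xs + countAbove (suc i) [ i ])
    ≡⟨ cong (λ k → countAbove (suc i) zs + (countAbove (suc i) xs + k)) (countAbove-∷-≤ (suc i) i [] (n≤1+n i)) ⟩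
  countAbove (suc i) zs + (countAbove (suc i) xs + 0)
    ≡⟨ trans (cong (countAbove (suc i) zs +_) (+-identityʳ _)) count ⟩
  c ∎
  where
  open ≡-Reasoning
  w = xs ++ i ∷ ys ++ suc i ∷ zs

Arc-Rot : ∀ {i c u v} → Arc i c u → Rot u v → Arc i c v
Arc-Rot {i} {c} (forward {[]} {ys} {zs} _ i∉ys i∉zs count) (rot _ _) =
  subst (Arc i c) (sym (++-assoc ys (i ∷ zs) [ suc i ]))
    (wrapped i∉ys i∉zs [] count)
Arc-Rot {i} {c} (forward {x ∷ xs} {ys} {zs} (x∉ ∷ i∉xs) i∉ys i∉zs count) (rot _ _) =
  subst (Arc i c) (sym (snoc-inner xs ys zs))
    (forward i∉xs i∉ys (++⁺ i∉zs (x∉ ∷ [])) count)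
Arc-Rot {i} {c} (wrapped {[]} {ys} {zs} _ i∉ys i∉zs count) (rot _ _) =
  subst (Arc i c) (sym (++-assoc ys (suc i ∷ zs) [ i ]))
    (forward i∉ys i∉zs [] (trans (sym (+-identityʳ _)) count))
Arc-Rot {i} {c} (wrapped {x ∷ xs} {ys} {zs} (x∉ ∷ i∉xs) i∉ys i∉zs count) (rot _ _) =
  subst (Arc i c) (sym (snoc-inner xs ys zs))
    (wrapped i∉xs i∉ys (++⁺ i∉zs (x∉ ∷ [])) count′)
  where
  open ≡-Reasoning
  count′ : countAbove (suc i) (zs ++ [ x ]) + countAbove (suc i) xs ≡ c
  count′ = begin
    countAbove (suc i) (zs ++ [ x ]) + countAbove (suc i) xs
      ≡⟨ cong (_+ countAbove (suc i) xs) (countAbove-++ (suc i) zs [ x ]) ⟩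
    countAbove (suc i) zs + countAbove (suc i) [ x ] + countAbove (suc i) xs
      ≡⟨ +-assoc (countAbove (suc i) zs) _ _ ⟩
    countAbove (suc i) zs + (countAbove (suc i) [ x ] + countAbove (suc i) xs)
      ≡⟨ cong (countAbove (suc i) zs +_) (sym (countAbove-++ (suc i) [ x ] xs)) ⟩
    countAbove (suc i) zs + countAbove (suc i) (x ∷ xs)
      ≡⟨ count ⟩
    c ∎

Rot*-++-comm : ∀ (xs ys : List ℕ) → Star Rot (xs ++ ys) (ys ++ xs)
Rot*-++-comm []       ys = subst (Star Rot ys) (sym (++-identityʳ ys)) ε
Rot*-++-comm (x ∷ xs) ys =
  rot x (xs ++ ys) ◅
    subst₂ (Star Rot) (sym (++-assoc xs ys [ x ])) (++-assoc ys [ x ] xs)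
      (Rot*-++-comm xs (ys ++ [ x ]))

Arc-Rot* : ∀ {i c u v} → Arc i c u → Star Rot u v → Arc i c v
Arc-Rot* arc ε        = arc
Arc-Rot* arc (r ◅ rs) = Arc-Rot* (Arc-Rot arc r) rs

<⇒Avoids : ∀ {i z} → z < i → i ≢ z × suc i ≢ z
<⇒Avoids z<i = (λ i≡z → <⇒≢ z<i (sym i≡z)) , (λ i+1≡z → <⇒≢ (m<n⇒m<1+n z<i) (sym i+1≡z))

>⇒Avoids : ∀ {i z} → suc i < z → i ≢ z × suc i ≢ z
>⇒Avoids i+1<z = (λ i≡z → <⇒≢ (<-trans (n<1+n _) i+1<z) i≡z) , (λ i+1≡z → <⇒≢ i+1<z i+1≡z)

Arc-∷ : ∀ {i c z w} → z < i → Arc i c w → Arc i c (z ∷ w)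
Arc-∷ z<i (forward i∉xs i∉ys i∉zs count) = forward (<⇒Avoids z<i ∷ i∉xs) i∉ys i∉zs count
Arc-∷ {i} {z = z} z<i (wrapped {xs} {_} {zs} i∉xs i∉ys i∉zs count) =
  wrapped (<⇒Avoids z<i ∷ i∉xs) i∉ys i∉zs
    (trans (cong (countAbove (suc i) zs +_) (countAbove-∷-≤ (suc i) z xs (≤-trans (<⇒≤ z<i) (n≤1+n i)))) count)

splice : ℕ → ℕ → List ℕ → List ℕ
splice d z t = drop d t ++ z ∷ take d t

Rot*-splice : ∀ d z t → Star Rot (z ∷ t) (splice d z t)
Rot*-splice d z t =
  subst (λ u → Star Rot (z ∷ u) (splice d z t)) (take++drop≡id d t)
    (Rot*-++-comm (z ∷ take d t) (drop d t))

Arc-splice : ∀ {i c} d z t → Arc i c (z ∷ t) → Arc i c (splice d z t)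
Arc-splice d z t arc = Arc-Rot* arc (Rot*-splice d z t)

Arc-splice-above : ∀ {i} d T → d ≤ length T → All (suc i <_) T → Arc i d (i ∷ splice d (suc i) T)
Arc-splice-above {i} d T d≤∣T∣ i+1<T =
  wrapped {xs = []} [] (All.map >⇒Avoids (drop⁺ d i+1<T)) (All.map >⇒Avoids (take⁺ d i+1<T))
    (begin
      countAbove (suc i) (take d T) + 0 ≡⟨ +-identityʳ _ ⟩
      countAbove (suc i) (take d T)     ≡⟨ countAbove-all (take⁺ d i+1<T) ⟩
      length (take d T)                 ≡⟨ length-take d T ⟩
      d ⊓ length T                      ≡⟨ m≤n⇒m⊓n≡m d≤∣T∣ ⟩
      d                                 ∎)
  where open ≡-Reasoning

spliceFrom : ℕ → ℕ → List ℕ → List ℕ → List ℕ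
spliceFrom n i t []       = t
spliceFrom n i t (b ∷ bs) = spliceFrom n (suc i) (splice (i ∸ b) (n ∸ i) t) bs

spliceFrom-++ : ∀ n i t bs cs → spliceFrom n i t (bs ++ cs) ≡ spliceFrom n (i + length bs) (spliceFrom n i t bs) cs
spliceFrom-++ n i t []       cs = cong (λ k → spliceFrom n k t cs) (sym (+-identityʳ i))
spliceFrom-++ n i t (b ∷ bs) cs =
  trans (spliceFrom-++ n (suc i) _ bs cs)
        (cong (λ k → spliceFrom n k (spliceFrom n (suc i) (splice (i ∸ b) (n ∸ i) t) bs) cs) (sym (+-suc i (length bs))))

length-splice : ∀ d z t → length (splice d z t) ≡ suc (length t)
length-splice d z t = begin
  length (drop d t ++ z ∷ take d t)           ≡⟨ length-++ (drop d t) ⟩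
  length (drop d t) + suc (length (take d t)) ≡⟨ +-suc _ _ ⟩
  suc (length (drop d t) + length (take d t)) ≡⟨ cong suc (+-comm (length (drop d t)) _) ⟩
  suc (length (take d t) + length (drop d t)) ≡⟨ cong suc (sym (length-++ (take d t))) ⟩
  suc (length (take d t ++ drop d t))         ≡⟨ cong (suc ∘ length) (take++drop≡id d t) ⟩
  suc (length t)                              ∎
  where open ≡-Reasoning

length-spliceFrom : ∀ n i t bs → length (spliceFrom n i t bs) ≡ length t + length bs
length-spliceFrom n i t []       = sym (+-identityʳ _)
length-spliceFrom n i t (b ∷ bs) =
  trans (length-spliceFrom n (suc i) _ bs) (trans (cong (_+ length bs) (length-splice (i ∸ b) (n ∸ i) t)) (sym (+-suc _ _)))

spliceFrom-preserves : ∀ {Q : List ℕ → Set} {R : ℕ → Set} →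
  (∀ d {z t} → R z → Q t → Q (splice d z t)) →
  ∀ n i t bs → (∀ k → i ≤ k → k < i + length bs → R (n ∸ k)) → Q t → Q (spliceFrom n i t bs)
spliceFrom-preserves pres n i t []       R-inserted q = q
spliceFrom-preserves pres n i t (b ∷ bs) R-inserted q =
  spliceFrom-preserves pres n (suc i) _ bs
    (λ k i<k k<end → R-inserted k (<⇒≤ i<k) (≤-trans k<end (≤-reflexive (sym (+-suc i (length bs))))))
    (pres (i ∸ b) (R-inserted i ≤-refl (m<m+n i z<s)) q)

data BoundedFrom : ℕ → List ℕ → Set where
  []  : ∀ {i} → BoundedFrom i []
  _∷_ : ∀ {i b bs} → b ≤ i → BoundedFrom (suc i) bs → BoundedFrom i (b ∷ bs)

length-oneTo : ∀ m → length (oneTo m) ≡ m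
length-oneTo m = trans (length-map suc (upTo m)) (length-upTo m)

oneTo-suc : ∀ m → oneTo (suc m) ≡ oneTo m ++ [ suc m ]
oneTo-suc m = trans (cong (map suc) (sym (upTo-∷ʳ m))) (map-++ suc (upTo m) [ m ])

step-oneTo : ∀ m i b t → b ≤ i →
  step (suc m + i) i b (oneTo (suc m) ++ t) ≡ oneTo m ++ splice (i ∸ b) (suc m + i ∸ i) t
step-oneTo m i b t b≤i =
  cong₂ (λ k u → oneTo k ++ u) (cong (_∸ 1) m+i∸i)
    (cong₂ (λ u v → u ++ (suc m + i ∸ i) ∷ take (i ∸ b) v) drop-prefix-and-more drop-prefix)
  where
  m+i∸i : suc m + i ∸ i ≡ suc m
  m+i∸i = m+n∸n≡m (suc m) i
  drop-prefix : drop (suc m + i ∸ i) (oneTo (suc m) ++ t) ≡ t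
  drop-prefix = trans (cong (λ k → drop k (oneTo (suc m) ++ t)) (trans m+i∸i (sym (length-oneTo (suc m)))))
                      (drop-length-++ (oneTo (suc m)) t)
  drop-prefix-and-more : drop (suc m + i ∸ b) (oneTo (suc m) ++ t) ≡ drop (i ∸ b) t
  drop-prefix-and-more =
    trans (cong (λ k → drop k (oneTo (suc m) ++ t))
                (trans (+-∸-assoc (suc m) b≤i) (cong (_+ (i ∸ b)) (sym (length-oneTo (suc m))))))
          (drop-++-length (oneTo (suc m)) t (i ∸ b))

iterS-oneTo : ∀ n i m t bs → m + i ≡ n → BoundedFrom i bs → length bs ≤ m →
  iterS n i (oneTo m ++ t) bs ≡ oneTo (m ∸ length bs) ++ spliceFrom n i t bs
iterS-oneTo n i m t [] _ _ _ = refl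
iterS-oneTo .(suc m + i) i (suc m) t (b ∷ bs) refl (b≤i ∷ bounded) (s≤s ∣bs∣≤m) =
  trans (cong (λ w → iterS (suc m + i) (suc i) w bs) (step-oneTo m i b t b≤i))
        (iterS-oneTo (suc m + i) (suc i) m _ bs (+-suc m i) bounded ∣bs∣≤m)

S-tail : ∀ p b → BoundedFrom 1 b → length b ≡ p → S (2 + p) b ≡ 1 ∷ spliceFrom (2 + p) 1 [ 2 + p ] b
S-tail p b bounded refl = begin
  iterS n 1 (oneTo n) b                       ≡⟨ cong (λ w → iterS n 1 w b) (oneTo-suc (suc p)) ⟩
  iterS n 1 (oneTo (suc p) ++ [ n ]) b        ≡⟨ iterS-oneTo n 1 (suc p) [ n ] b (+-comm (suc p) 1) bounded (n≤1+n p) ⟩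
  oneTo (suc p ∸ p) ++ spliceFrom n 1 [ n ] b ≡⟨ cong (λ k → oneTo k ++ spliceFrom n 1 [ n ] b) (m+n∸n≡m 1 p) ⟩
  1 ∷ spliceFrom n 1 [ n ] b                  ∎
  where
  open ≡-Reasoning
  n = 2 + p

BoundedFrom⇒at-≤ : ∀ {i bs} → BoundedFrom i bs → ∀ j → suc j ≤ length bs → at bs (suc j) ≤ i + j
BoundedFrom⇒at-≤ {i} (b≤i ∷ _)       zero    _         = ≤-trans b≤i (m≤m+n i 0)
BoundedFrom⇒at-≤ {i} (_ ∷ bounded) (suc j) (s≤s j<∣bs∣) =
  ≤-trans (BoundedFrom⇒at-≤ bounded j j<∣bs∣) (≤-reflexive (sym (+-suc i j)))

at-≤⇒BoundedFrom : ∀ {i} bs → (∀ j → suc j ≤ length bs → at bs (suc j) ≤ i + j) → BoundedFrom i bs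
at-≤⇒BoundedFrom       []       _      = []
at-≤⇒BoundedFrom {i} (b ∷ bs) at-≤ =
  ≤-trans (at-≤ 0 (s≤s z≤n)) (≤-reflexive (+-identityʳ i)) ∷
  at-≤⇒BoundedFrom bs (λ j j<∣bs∣ → ≤-trans (at-≤ (suc j) (s≤s j<∣bs∣)) (≤-reflexive (+-suc i j)))

Valid⇒BoundedFrom : ∀ {n b} → Valid n b → BoundedFrom 1 b
Valid⇒BoundedFrom {b = b} (∣b∣≡ , b≤) =
  at-≤⇒BoundedFrom b (λ j j<∣b∣ → b≤ (suc j) (s≤s z≤n) (≤-trans j<∣b∣ (≤-reflexive ∣b∣≡)))

BoundedFrom⇒Valid : ∀ {n b} → length b ≡ n ∸ 2 → BoundedFrom 1 b → Valid n b
BoundedFrom⇒Valid ∣b∣≡ bounded =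
  ∣b∣≡ , λ { (suc j) _ j<n-2 → BoundedFrom⇒at-≤ bounded j (≤-trans j<n-2 (≤-reflexive (sym ∣b∣≡))) }

All-splice : ∀ {P : ℕ → Set} d {z t} → P z → All P t → All P (splice d z t)
All-splice d Pz Pt = ++⁺ (drop⁺ d Pt) (Pz ∷ take⁺ d Pt)

spliceFrom-≥ : ∀ n bs → All (n ∸ length bs ≤_) (spliceFrom n 1 [ n ] bs)
spliceFrom-≥ n bs =
  spliceFrom-preserves All-splice n 1 [ n ] bs
    (λ k _ k≤∣bs∣ → ∸-monoʳ-≤ n (s≤s⁻¹ k≤∣bs∣))
    (m∸n≤m n (length bs) ∷ [])

Arc-completion : ∀ {d} n k y t rest → n ≡ k + y → suc (length rest) ≡ y →
                 Arc y d (y ∷ t) → Arc y d (1 ∷ spliceFrom n k t rest)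
Arc-completion n k y t []         _    refl arc = arc
Arc-completion {d} n k y t (c ∷ rest) n≡k+y refl arc =
  Arc-∷ (s≤s (s≤s z≤n))
    (spliceFrom-preserves {Arc y d} {_< y} (λ e z<y → Arc-splice e _ _ ∘ Arc-∷ z<y) n (suc k) _ rest
      (λ m k<m _ → m<n+o⇒m∸n<o n m (subst (_< m + y) (sym n≡k+y) (+-monoˡ-< y k<m)))
      (Arc-splice (k ∸ c) (n ∸ k) t (subst (λ z → Arc y d (z ∷ t)) (sym n∸k≡y) arc)))
  where
  n∸k≡y : n ∸ k ≡ y
  n∸k≡y = trans (cong (_∸ k) n≡k+y) (m+n∸m≡n k y)

α-S-++-∷ : ∀ b₁ x rest → BoundedFrom 1 (b₁ ++ x ∷ rest) →
  α (suc (length rest)) (S (2 + suc (length rest) + length b₁) (b₁ ++ x ∷ rest)) ≡ suc (length b₁) ∸ x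
α-S-++-∷ b₁ x rest bounded =
  α-Arc (subst (Arc y d) (sym S≡)
    (Arc-completion n (2 + j) y T₂ rest (cong (2 +_) (+-comm y j)) refl
      (Arc-splice-above d T₁ d≤∣T₁∣ T₁-above)))
  where
  open ≡-Reasoning
  j = length b₁
  y = suc (length rest)
  n = 2 + y + j
  d = suc j ∸ x
  T₁ = spliceFrom n 1 [ n ] b₁
  T₂ = splice d (suc y) T₁
  d≤∣T₁∣ : d ≤ length T₁
  d≤∣T₁∣ = ≤-trans (m∸n≤m (suc j) x) (≤-reflexive (sym (length-spliceFrom n 1 [ n ] b₁)))
  T₁-above : All (suc y <_) T₁
  T₁-above = All.map (≤-trans (≤-reflexive (sym (m+n∸n≡m (2 + y) j)))) (spliceFrom-≥ n b₁)
  S≡ : S n (b₁ ++ x ∷ rest) ≡ 1 ∷ spliceFrom n (2 + j) T₂ rest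
  S≡ = begin
    S n (b₁ ++ x ∷ rest)
      ≡⟨ S-tail (y + j) _ bounded (trans (length-++ b₁) (+-comm j y)) ⟩
    1 ∷ spliceFrom n 1 [ n ] (b₁ ++ x ∷ rest)
      ≡⟨ cong (1 ∷_) (spliceFrom-++ n 1 [ n ] b₁ (x ∷ rest)) ⟩
    1 ∷ spliceFrom n (2 + j) (splice d (n ∸ suc j) T₁) rest
      ≡⟨ cong (λ z → 1 ∷ spliceFrom n (2 + j) (splice d z T₁) rest) (m+n∸n≡m (suc y) j) ⟩
    1 ∷ spliceFrom n (2 + j) T₂ rest ∎

split-at : ∀ j r (bs : List ℕ) → length bs ≡ j + suc r →
  ∃[ b₁ ] ∃[ x ] ∃[ rest ] (bs ≡ b₁ ++ x ∷ rest × length b₁ ≡ j × length rest ≡ r)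
split-at zero    r (x ∷ bs) ∣bs∣≡ = [] , x , bs , refl , refl , suc-injective ∣bs∣≡
split-at (suc j) r (b ∷ bs) ∣bs∣≡ with split-at j r bs (suc-injective ∣bs∣≡)
... | b₁ , x , rest , refl , refl , ∣rest∣≡ = b ∷ b₁ , x , rest , refl , refl , ∣rest∣≡

at-++-∷ : ∀ b₁ x rest → at (b₁ ++ x ∷ rest) (suc (length b₁)) ≡ x
at-++-∷ []       x rest = refl
at-++-∷ (b ∷ b₁) x rest = at-++-∷ b₁ x rest

α-S : (n : ℕ) → 2 ≤ n → (b : List ℕ) → Valid n b →
      ∀ i → 1 ≤ i → i ≤ n ∸ 2 → α i (S n b) ≡ n ∸ 1 ∸ i ∸ at b (n ∸ 1 ∸ i)
α-S (suc (suc p)) _ b valid@(∣b∣≡ , _) (suc r) _ i≤p with m≤n⇒∃[o]m+o≡n i≤p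
... | j , refl with split-at j r b (trans ∣b∣≡ (+-comm (suc r) j))
... | b₁ , x , rest , refl , refl , refl =
  trans (α-S-++-∷ b₁ x rest (Valid⇒BoundedFrom {suc (suc p)} valid))
        (sym (trans (cong (λ k → k ∸ at (b₁ ++ x ∷ rest) k) n-1-i≡) (cong (suc j ∸_) (at-++-∷ b₁ x rest))))
  where
  n-1-i≡ : suc (length rest + j) ∸ length rest ≡ suc j
  n-1-i≡ = trans (cong (_∸ length rest) (sym (+-suc (length rest) j))) (m+n∸m≡n (length rest) (suc j))

interval : ℕ → ℕ → List ℕ
interval a zero    = []
interval a (suc k) = a ∷ interval (suc a) k

length-interval : ∀ a k → length (interval a k) ≡ k
length-interval a zero    = refl
length-interval a (suc k) = cong suc (length-interval (suc a) k)

applyUpTo-interval : ∀ {a} (f : ℕ → ℕ) k → (∀ j → f j ≡ a + j) → applyUpTo f k ≡ interval a k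
applyUpTo-interval         f zero    _   = refl
applyUpTo-interval {a} f (suc k) f≡ =
  cong₂ _∷_ (trans (f≡ 0) (+-identityʳ a))
            (applyUpTo-interval (f ∘ suc) k (λ j → trans (f≡ (suc j)) (+-suc a j)))

oneTo≡interval : ∀ n → oneTo n ≡ interval 1 n
oneTo≡interval n = trans (map-upTo suc n) (applyUpTo-interval suc n (λ _ → refl))

BoundedFrom-∷ʳ : ∀ {i} bs {c} → BoundedFrom i bs → c ≤ i + length bs → BoundedFrom i (bs ++ [ c ])
BoundedFrom-∷ʳ {i} []       []              c≤ = ≤-trans c≤ (≤-reflexive (+-identityʳ i)) ∷ []
BoundedFrom-∷ʳ {i} (b ∷ bs) (b≤i ∷ bounded) c≤ =
  b≤i ∷ BoundedFrom-∷ʳ bs bounded (≤-trans c≤ (≤-reflexive (+-suc i (length bs))))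

splice-length-++ : ∀ z (xs ys : List ℕ) → splice (length xs) z (xs ++ ys) ≡ ys ++ z ∷ xs
splice-length-++ z xs ys =
  cong₂ (λ us vs → us ++ z ∷ vs) (drop-length-++ xs ys)
        (trans (cong (λ k → take k (xs ++ ys)) (sym (+-identityʳ _))) (trans (take-++-length xs ys 0) (++-identityʳ xs)))

↭-∷-rotate : ∀ {a : ℕ} {us} xs ys → xs ++ a ∷ ys ↭ a ∷ us → ys ++ xs ↭ us
↭-∷-rotate xs ys p = ↭-trans (↭-++-comm ys xs) (drop-mid xs [] p)

spliceFrom-onto : ∀ n k a t → a + k ≡ n → t ↭ interval a (suc k) →
  ∃[ b ] (length b ≡ k × BoundedFrom 1 b × spliceFrom n 1 [ n ] b ≡ t)
spliceFrom-onto n zero a t a+0≡n t↭a =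
  [] , refl , [] , sym (trans (↭-singleton-inv t↭a) (cong [_] (trans (sym (+-identityʳ a)) a+0≡n)))
spliceFrom-onto n (suc k) a t a+k+1≡n t↭ with ∈-∃++ (∈-resp-↭ (↭-sym t↭) (here refl))
... | xs , ys , refl with spliceFrom-onto n k (suc a) (ys ++ xs) (trans (sym (+-suc a k)) a+k+1≡n) (↭-∷-rotate xs ys t↭)
... | b , refl , bounded , spliceFrom-b≡ =
  b ++ [ c ] , trans (length-++ b) (+-comm (length b) 1) ,
  BoundedFrom-∷ʳ b bounded (m∸n≤m (suc (length b)) (length ys)) ,
  (begin
    spliceFrom n 1 [ n ] (b ++ [ c ])
      ≡⟨ spliceFrom-++ n 1 [ n ] b [ c ] ⟩
    splice (suc (length b) ∸ c) (n ∸ suc (length b)) (spliceFrom n 1 [ n ] b)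
      ≡⟨ cong₂ (λ e z → splice e z (spliceFrom n 1 [ n ] b)) (m∸[m∸n]≡n ∣ys∣≤)
               (trans (cong (_∸ suc (length b)) (sym a+k+1≡n)) (m+n∸n≡m a (suc (length b)))) ⟩
    splice (length ys) a (spliceFrom n 1 [ n ] b)
      ≡⟨ cong (splice (length ys) a) spliceFrom-b≡ ⟩
    splice (length ys) a (ys ++ xs)
      ≡⟨ splice-length-++ a ys xs ⟩
    xs ++ a ∷ ys ∎)
  where
  open ≡-Reasoning
  c = suc (length b) ∸ length ys
  ∣ys∣≤ : length ys ≤ suc (length b)
  ∣ys∣≤ = ≤-trans (m≤m+n (length ys) (length xs))
            (≤-reflexive (trans (sym (length-++ ys))
              (trans (↭-length (↭-∷-rotate xs ys t↭)) (length-interval (suc a) _))))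

S-cyclic-representative : (n : ℕ) → 2 ≤ n → (w : List ℕ) → w ↭ interval 1 n →
                          Σ[ b ∈ List ℕ ] (Valid n b × CycEq w (S n b))
S-cyclic-representative (suc (suc p)) (s≤s (s≤s _)) w w↭ with ∈-∃++ (∈-resp-↭ (↭-sym w↭) (here refl))
... | xs , ys , refl with spliceFrom-onto (2 + p) p 2 (ys ++ xs) refl (↭-∷-rotate xs ys w↭)
... | b , refl , bounded , spliceFrom≡ =
  b , BoundedFrom⇒Valid {2 + length b} refl bounded ,
  subst (CycEq (xs ++ 1 ∷ ys)) (sym (trans (S-tail (length b) b bounded refl) (cong (1 ∷_) spliceFrom≡)))
    (Star.map fwd (Rot*-++-comm xs (1 ∷ ys)))

lemma10p5 : (n : ℕ) → 2 ≤ n →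
    ((b : List ℕ) → Valid n b →
    ∀ i → 1 ≤ i → i ≤ n ∸ 2 → α i (S n b) ≡ n ∸ 1 ∸ i ∸ at b (n ∸ 1 ∸ i))
    × ((w : List ℕ) → w ↭ oneTo n → Σ[ b ∈ List ℕ ] (Valid n b × CycEq w (S n b)))
lemma10p5 n 2≤n =
  α-S n 2≤n ,
  λ w w↭ → S-cyclic-representative n 2≤n w (subst (w ↭_) (oneTo≡interval n) w↭)
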